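{- Let $d$ be an integer with $d\notin\{1,-1,2,-2\}$. Then the negative polynomial Pell equation $$P^2(X)-(X^2+d)\,Q^2(X)=-1$$ has no non-trivial solutions $P(X),Q(X)$ with coefficients in the Gaussian integers $\mathbb{Z}[i]$.
   Context: A solution is a pair of polynomials $P(X),Q(X)\in\mathbb{Z}[i][X]$ satisfying the equation identically. It is called non-trivial if $Q(X)\neq 0$ (equivalently, $P(X)$ is non-constant); the trivial solutions are $P=\pm i$, $Q=0$. -}

module Defs where

open import Data.Integer as ℤ using (ℤ; +_; 0ℤ; 1ℤ)
open import Data.Nat using (ℕ; zero; suc)
open import Data.List using (List; []; _∷_)
open import Data.Product using (_×_; _,_)

record ℤ[i] : Set where
  constructor _+_i
  field
    re : ℤ
    im : ℤ
open ℤ[i] public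

0G 1G : ℤ[i]
0G = 0ℤ + 0ℤ i
1G = 1ℤ + 0ℤ i

infixl 6 _+G_
infixl 7 _*G_
_+G_ : ℤ[i] → ℤ[i] → ℤ[i]
(a + b i) +G (c + d i) = (a ℤ.+ c) + (b ℤ.+ d) i

_*G_ : ℤ[i] → ℤ[i] → ℤ[i]
(a + b i) *G (c + d i) = (a ℤ.* c ℤ.- b ℤ.* d) + (a ℤ.* d ℤ.+ b ℤ.* c) i

-G_ : ℤ[i] → ℤ[i]
-G (a + b i) = (ℤ.- a) + (ℤ.- b) i

ι : ℤ → ℤ[i]
ι a = a + 0ℤ i

-- Polynomials over ℤ[i] as coefficient lists, lowest degree first:
-- a₀ ∷ a₁ ∷ … represents a₀ + a₁ X + …  (trailing zeros allowed)
Poly : Set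
Poly = List ℤ[i]

coeff : Poly → ℕ → ℤ[i]
coeff []       _       = 0G
coeff (a ∷ p)  zero    = a
coeff (a ∷ p)  (suc n) = coeff p n

infixl 6 _⊕_
infixl 7 _⊗_ _·_
_⊕_ : Poly → Poly → Poly
[]      ⊕ q       = q
p       ⊕ []      = p
(a ∷ p) ⊕ (b ∷ q) = (a +G b) ∷ (p ⊕ q)

_·_ : ℤ[i] → Poly → Poly
c · []      = []
c · (a ∷ p) = (c *G a) ∷ (c · p)

_⊗_ : Poly → Poly → Poly
[]      ⊗ q = []
(a ∷ p) ⊗ q = (a · q) ⊕ (0G ∷ (p ⊗ q))

⊖_ : Poly → Poly
⊖ p = (-G 1G) · p

infix 4 _≈P_
_≈P_ : Poly → Poly → Set
p ≈P q = ∀ n → coeff p n ≡ coeff q n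
  where open import Relation.Binary.PropositionalEquality using (_≡_)

IsZeroPoly : Poly → Set
IsZeroPoly p = p ≈P []

X²+ : ℤ → Poly
X²+ d = ι d ∷ 0G ∷ 1G ∷ []

NegPell : ℤ → Poly → Poly → Set
NegPell d P Q = (P ⊗ P) ⊕ (⊖ (X²+ d ⊗ (Q ⊗ Q))) ≈P (-G 1G ∷ [])

-- Let p² − (X² + d) q² = c with c a constant and q ≠ 0. Comparing top coefficients forces
-- deg p = deg q + 1, q's leading coefficient to be ± p's (say +) and the next coefficients to agree;
-- then (Xp − (X² + d) q, Xq − p), i.e. (p + q√(X²+d))(X − √(X²+d)), is a solution of smaller degree
-- with constant −d·c. Descending to a constant p relates the leading coefficient a to c by
-- 4a²(−d)^(k+1) = c·4^(k+1). For c = −1 taking norms gives 16·N(a)²·d^(2k+2) = 16^(k+1), impossible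
-- when |d| ≥ 3: for |d| = 3 the left side is divisible by 3, for |d| ≥ 4 it is too large.
-- For d = 0 the equation reads (p − Xq)(p + Xq) = −1, so both factors are constant and q = 0.

module Submission where

open import Defs
open import Algebra.Bundles using (CommutativeRing; RawRing)
open import Algebra.Structures using (IsCommutativeRing)
import Algebra.Definitions.RawSemiring as RawSemiringDefinitions
import Algebra.Solver.Ring as RingSolver
open import Algebra.Solver.Ring.AlmostCommutativeRing
  using (_-Raw-AlmostCommutative⟶_; fromCommutativeRing)
import Algebra.Solver.Ring.Simple as SimpleRingSolver
open import Data.Empty using (⊥-elim)
open import Data.Integer as ℤ using (ℤ; +_; -[1+_]; 0ℤ; 1ℤ)
import Data.Integer.Properties as ℤP
open import Data.Integer.Solver using (module +-*-Solver)
open import Data.List using ([]; _∷_; length)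
open import Data.Maybe using (Maybe; just; nothing)
open import Data.Nat as ℕ using (ℕ; zero; suc; _≤_; z≤n; s≤s)
open import Data.Nat.Divisibility using (_∣_; divides; ∣1⇒≡1; ∣m+n∣m⇒∣n; ∣m⇒∣m*n; ∣n⇒∣m*n)
import Data.Nat.Properties as ℕP
open import Data.Product using (Σ-syntax; _×_; _,_)
open import Data.Sum using (_⊎_; inj₁; inj₂; [_,_]′)
open import Function using (_∘_; id; case_of_)
open import Relation.Binary.Bundles using (Setoid)
open import Relation.Binary.PropositionalEquality
import Relation.Binary.Reasoning.Setoid as SetoidReasoning
open import Relation.Nullary using (¬_; Dec; yes; no)

module GaussianRing where

  open +-*-Solver

  ≡-+i : ∀ {a b c d} → a ≡ c → b ≡ d → a + b i ≡ c + d i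
  ≡-+i = cong₂ _+_i

  +G-assoc : ∀ x y z → (x +G y) +G z ≡ x +G (y +G z)
  +G-assoc (a + b i) (c + d i) (e + f i) = ≡-+i (ℤP.+-assoc a c e) (ℤP.+-assoc b d f)

  +G-comm : ∀ x y → x +G y ≡ y +G x
  +G-comm (a + b i) (c + d i) = ≡-+i (ℤP.+-comm a c) (ℤP.+-comm b d)

  +G-identityˡ : ∀ x → 0G +G x ≡ x
  +G-identityˡ (a + b i) = ≡-+i (ℤP.+-identityˡ a) (ℤP.+-identityˡ b)

  +G-identityʳ : ∀ x → x +G 0G ≡ x
  +G-identityʳ (a + b i) = ≡-+i (ℤP.+-identityʳ a) (ℤP.+-identityʳ b)

  -G-inverseˡ : ∀ x → (-G x) +G x ≡ 0G
  -G-inverseˡ (a + b i) = ≡-+i (ℤP.+-inverseˡ a) (ℤP.+-inverseˡ b)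

  -G-inverseʳ : ∀ x → x +G (-G x) ≡ 0G
  -G-inverseʳ (a + b i) = ≡-+i (ℤP.+-inverseʳ a) (ℤP.+-inverseʳ b)

  -G-involutive : ∀ x → -G (-G x) ≡ x
  -G-involutive (a + b i) = ≡-+i (ℤP.neg-involutive a) (ℤP.neg-involutive b)

  *G-assoc : ∀ x y z → (x *G y) *G z ≡ x *G (y *G z)
  *G-assoc (a + b i) (c + d i) (e + f i) = ≡-+i
    (solve 6 (λ a b c d e f → (a :* c :- b :* d) :* e :- (a :* d :+ b :* c) :* f
                          := a :* (c :* e :- d :* f) :- b :* (c :* f :+ d :* e)) refl a b c d e f)
    (solve 6 (λ a b c d e f → (a :* c :- b :* d) :* f :+ (a :* d :+ b :* c) :* e
                          := a :* (c :* f :+ d :* e) :+ b :* (c :* e :- d :* f)) refl a b c d e f)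

  *G-comm : ∀ x y → x *G y ≡ y *G x
  *G-comm (a + b i) (c + d i) = ≡-+i
    (solve 4 (λ a b c d → a :* c :- b :* d := c :* a :- d :* b) refl a b c d)
    (solve 4 (λ a b c d → a :* d :+ b :* c := c :* b :+ d :* a) refl a b c d)

  *G-identityˡ : ∀ x → 1G *G x ≡ x
  *G-identityˡ (a + b i) = ≡-+i
    (solve 2 (λ a b → con 1ℤ :* a :- con 0ℤ :* b := a) refl a b)
    (solve 2 (λ a b → con 1ℤ :* b :+ con 0ℤ :* a := b) refl a b)

  *G-identityʳ : ∀ x → x *G 1G ≡ x
  *G-identityʳ x = trans (*G-comm x 1G) (*G-identityˡ x)

  *G-distribʳ : ∀ x y z → (y +G z) *G x ≡ (y *G x) +G (z *G x)
  *G-distribʳ (a + b i) (c + d i) (e + f i) = ≡-+i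
    (solve 6 (λ a b c d e f → (c :+ e) :* a :- (d :+ f) :* b
                          := (c :* a :- d :* b) :+ (e :* a :- f :* b)) refl a b c d e f)
    (solve 6 (λ a b c d e f → (c :+ e) :* b :+ (d :+ f) :* a
                          := (c :* b :+ d :* a) :+ (e :* b :+ f :* a)) refl a b c d e f)

  *G-distribˡ : ∀ x y z → x *G (y +G z) ≡ (x *G y) +G (x *G z)
  *G-distribˡ x y z =
    trans (*G-comm x _) (trans (*G-distribʳ x y z) (cong₂ _+G_ (*G-comm y x) (*G-comm z x)))

  *G-zeroˡ : ∀ x → 0G *G x ≡ 0G
  *G-zeroˡ (a + b i) = ≡-+i
    (solve 2 (λ a b → con 0ℤ :* a :- con 0ℤ :* b := con 0ℤ) refl a b)
    (solve 2 (λ a b → con 0ℤ :* b :+ con 0ℤ :* a := con 0ℤ) refl a b)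

  *G-zeroʳ : ∀ x → x *G 0G ≡ 0G
  *G-zeroʳ x = trans (*G-comm x 0G) (*G-zeroˡ x)

  ι-* : ∀ x y → ι (x ℤ.* y) ≡ ι x *G ι y
  ι-* x y = ≡-+i
    (solve 2 (λ x y → x :* y := x :* y :- con 0ℤ :* con 0ℤ) refl x y)
    (solve 2 (λ x y → con 0ℤ := x :* con 0ℤ :+ con 0ℤ :* y) refl x y)

  ℤ[i]-isCommutativeRing : IsCommutativeRing _≡_ _+G_ _*G_ -G_ 0G 1G
  ℤ[i]-isCommutativeRing = record
    { isRing = record
      { +-isAbelianGroup = record
        { isGroup = record
          { isMonoid = record
            { isSemigroup = record
              { isMagma = record { isEquivalence = isEquivalence ; ∙-cong = cong₂ _+G_ }
              ; assoc = +G-assoc }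
            ; identity = +G-identityˡ , +G-identityʳ }
          ; inverse = -G-inverseˡ , -G-inverseʳ
          ; ⁻¹-cong = cong -G_ }
        ; comm = +G-comm }
      ; *-cong = cong₂ _*G_
      ; *-assoc = *G-assoc
      ; *-identity = *G-identityˡ , *G-identityʳ
      ; distrib = *G-distribˡ , *G-distribʳ }
    ; *-comm = *G-comm }

  ℤ[i]-commutativeRing : CommutativeRing _ _
  ℤ[i]-commutativeRing = record { isCommutativeRing = ℤ[i]-isCommutativeRing }

  infix 4 _≟G_
  _≟G_ : (x y : ℤ[i]) → Dec (x ≡ y)
  (a + b i) ≟G (c + d i) with a ℤ.≟ c | b ℤ.≟ d
  ... | yes refl | yes refl = yes refl
  ... | no a≢c   | _        = no λ { refl → a≢c refl }
  ... | yes _    | no b≢d   = no λ { refl → b≢d refl }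

  norm : ℤ[i] → ℕ
  norm (a + b i) = ℤ.∣ a ∣ ℕ.* ℤ.∣ a ∣ ℕ.+ ℤ.∣ b ∣ ℕ.* ℤ.∣ b ∣

  +norm : ∀ x → + norm x ≡ re x ℤ.* re x ℤ.+ im x ℤ.* im x
  +norm (a + b i) = cong₂ ℤ._+_ (+∣i∣*∣i∣ a) (+∣i∣*∣i∣ b)
    where
    +∣i∣*∣i∣ : ∀ a → + (ℤ.∣ a ∣ ℕ.* ℤ.∣ a ∣) ≡ a ℤ.* a
    +∣i∣*∣i∣ (+ n)    = sym (ℤP.+◃n≡+n (n ℕ.* n))
    +∣i∣*∣i∣ -[1+ n ] = sym (ℤP.+◃n≡+n _)

  norm-* : ∀ x y → norm (x *G y) ≡ norm x ℕ.* norm y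
  norm-* x@(a + b i) y@(c + d i) = ℤP.+-injective (begin
    + norm (x *G y)                                     ≡⟨ +norm (x *G y) ⟩
    (a ℤ.* c ℤ.- b ℤ.* d) ℤ.* (a ℤ.* c ℤ.- b ℤ.* d)
      ℤ.+ (a ℤ.* d ℤ.+ b ℤ.* c) ℤ.* (a ℤ.* d ℤ.+ b ℤ.* c) ≡⟨ brahmagupta a b c d ⟩
    (a ℤ.* a ℤ.+ b ℤ.* b) ℤ.* (c ℤ.* c ℤ.+ d ℤ.* d)      ≡⟨ cong₂ ℤ._*_ (+norm x) (+norm y) ⟨
    + norm x ℤ.* + norm y                               ≡⟨ ℤP.pos-* (norm x) (norm y) ⟨
    + (norm x ℕ.* norm y)                               ∎)
    where
    open ≡-Reasoning
    brahmagupta : ∀ a b c d → (a ℤ.* c ℤ.- b ℤ.* d) ℤ.* (a ℤ.* c ℤ.- b ℤ.* d)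
                              ℤ.+ (a ℤ.* d ℤ.+ b ℤ.* c) ℤ.* (a ℤ.* d ℤ.+ b ℤ.* c)
                            ≡ (a ℤ.* a ℤ.+ b ℤ.* b) ℤ.* (c ℤ.* c ℤ.+ d ℤ.* d)
    brahmagupta = solve 4 (λ a b c d →
      (a :* c :- b :* d) :* (a :* c :- b :* d) :+ (a :* d :+ b :* c) :* (a :* d :+ b :* c)
      := (a :* a :+ b :* b) :* (c :* c :+ d :* d)) refl

  norm≡0⇒≡0G : ∀ x → norm x ≡ 0 → x ≡ 0G
  norm≡0⇒≡0G (a + b i) eq = ≡-+i (∣i∣*∣i∣≡0⇒i≡0 a (ℕP.m+n≡0⇒m≡0 _ eq)) (∣i∣*∣i∣≡0⇒i≡0 b (ℕP.m+n≡0⇒n≡0 _ eq))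
    where
    ∣i∣*∣i∣≡0⇒i≡0 : ∀ a → ℤ.∣ a ∣ ℕ.* ℤ.∣ a ∣ ≡ 0 → a ≡ 0ℤ
    ∣i∣*∣i∣≡0⇒i≡0 a eq with ℕP.m*n≡0⇒m≡0∨n≡0 ℤ.∣ a ∣ eq
    ... | inj₁ ∣a∣≡0 = ℤP.∣i∣≡0⇒i≡0 ∣a∣≡0
    ... | inj₂ ∣a∣≡0 = ℤP.∣i∣≡0⇒i≡0 ∣a∣≡0

  norm-ι : ∀ z → norm (ι z) ≡ ℤ.∣ z ∣ ℕ.* ℤ.∣ z ∣
  norm-ι z = ℕP.+-identityʳ _

  x*y≡0⇒x≡0∨y≡0 : ∀ x y → x *G y ≡ 0G → x ≡ 0G ⊎ y ≡ 0G
  x*y≡0⇒x≡0∨y≡0 x y eq with ℕP.m*n≡0⇒m≡0∨n≡0 (norm x) (trans (sym (norm-* x y)) (cong norm eq))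
  ... | inj₁ Nx≡0 = inj₁ (norm≡0⇒≡0G x Nx≡0)
  ... | inj₂ Ny≡0 = inj₂ (norm≡0⇒≡0G y Ny≡0)

open GaussianRing

module ℤ[i]-Solver = SimpleRingSolver (fromCommutativeRing ℤ[i]-commutativeRing) _≟G_

x-y≡0⇒x≡y : ∀ x y → x +G -G y ≡ 0G → x ≡ y
x-y≡0⇒x≡y x y eq = begin
  x                  ≡⟨ solve 2 (λ x y → x := (x :- y) :+ y) refl x y ⟩
  (x +G -G y) +G y   ≡⟨ cong (_+G y) eq ⟩
  0G +G y            ≡⟨ +G-identityˡ y ⟩
  y                  ∎
  where
  open ≡-Reasoning
  open ℤ[i]-Solver

*G-cancelˡ : ∀ a {x y} → a ≢ 0G → a *G x ≡ a *G y → x ≡ y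
*G-cancelˡ a {x} {y} a≢0 eq =
  [ ⊥-elim ∘ a≢0 , x-y≡0⇒x≡y x y ]′ (x*y≡0⇒x≡0∨y≡0 a (x +G -G y) a[x-y]≡0)
  where
  open ≡-Reasoning
  open ℤ[i]-Solver
  a[x-y]≡0 : a *G (x +G -G y) ≡ 0G
  a[x-y]≡0 = begin
    a *G (x +G -G y)          ≡⟨ solve 3 (λ a x y → a :* (x :- y) := a :* x :- a :* y) refl a x y ⟩
    a *G x +G -G (a *G y)     ≡⟨ cong (λ z → z +G -G (a *G y)) eq ⟩
    a *G y +G -G (a *G y)     ≡⟨ -G-inverseʳ (a *G y) ⟩
    0G                        ∎

x²≡y²⇒y≡±x : ∀ x y → x *G x ≡ y *G y → y ≡ x ⊎ y ≡ -G x
x²≡y²⇒y≡±x x y eq =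
  [ inj₁ ∘ sym ∘ x-y≡0⇒x≡y x y , inj₂ ∘ x+y≡0⇒y≡-x ]′ (x*y≡0⇒x≡0∨y≡0 (x +G -G y) (x +G y) [x-y][x+y]≡0)
  where
  open ≡-Reasoning
  open ℤ[i]-Solver
  [x-y][x+y]≡0 : (x +G -G y) *G (x +G y) ≡ 0G
  [x-y][x+y]≡0 = begin
    (x +G -G y) *G (x +G y)   ≡⟨ solve 2 (λ x y → (x :- y) :* (x :+ y) := x :* x :- y :* y) refl x y ⟩
    x *G x +G -G (y *G y)     ≡⟨ cong (λ z → z +G -G (y *G y)) eq ⟩
    y *G y +G -G (y *G y)     ≡⟨ -G-inverseʳ (y *G y) ⟩
    0G                        ∎
  x+y≡0⇒y≡-x : x +G y ≡ 0G → y ≡ -G x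
  x+y≡0⇒y≡-x x+y≡0 = x-y≡0⇒x≡y y (-G x) (trans (solve 2 (λ x y → y :- (:- x) := x :+ y) refl x y) x+y≡0)

x+x≡0⇒x≡0 : ∀ {x} → x +G x ≡ 0G → x ≡ 0G
x+x≡0⇒x≡0 {x} x+x≡0 = [ (λ ()) , id ]′ (x*y≡0⇒x≡0∨y≡0 (1G +G 1G) x (trans 2x≡x+x x+x≡0))
  where
  open ℤ[i]-Solver
  2x≡x+x : (1G +G 1G) *G x ≡ x +G x
  2x≡x+x = solve 1 (λ x → (con 1G :+ con 1G) :* x := x :+ x) refl x

open RawSemiringDefinitions (RawRing.rawSemiring (CommutativeRing.rawRing ℤ[i]-commutativeRing)) using (_^_)

norm-^ : ∀ x n → norm (x ^ n) ≡ norm x ℕ.^ n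
norm-^ x zero    = refl
norm-^ x (suc n) = trans (norm-* x (x ^ n)) (cong (norm x ℕ.*_) (norm-^ x n))

-- Polynomials are handled as coefficient sequences with a degree bound (DegBelow), not as lists.
Seq : Set
Seq = ℕ → ℤ[i]

infixl 6 _+ₛ_
infixl 7 _*ₛ_ _·ₛ_
_+ₛ_ : Seq → Seq → Seq
(f +ₛ g) n = f n +G g n

-ₛ_ : Seq → Seq
(-ₛ f) n = -G f n

_·ₛ_ : ℤ[i] → Seq → Seq
(c ·ₛ f) n = c *G f n

const : ℤ[i] → Seq
const c zero    = c
const c (suc n) = 0G

0ₛ 1ₛ : Seq
0ₛ _ = 0G
1ₛ   = const 1G

tail : Seq → Seq
tail f n = f (suc n)

shift : Seq → Seq
shift f zero    = 0G
shift f (suc n) = f n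

_*ₛ_ : Seq → Seq → Seq
(f *ₛ g) zero    = f 0 *G g 0
(f *ₛ g) (suc n) = f 0 *G g (suc n) +G (tail f *ₛ g) n

module ≗-Reasoning = SetoidReasoning (ℕ →-setoid ℤ[i])

module SeqRing where

  open ℤ[i]-Solver

  +ₛ-cong : ∀ {f f′ g g′} → f ≗ f′ → g ≗ g′ → f +ₛ g ≗ f′ +ₛ g′
  +ₛ-cong f≗f′ g≗g′ n = cong₂ _+G_ (f≗f′ n) (g≗g′ n)

  -ₛ-cong : ∀ {f g} → f ≗ g → -ₛ f ≗ -ₛ g
  -ₛ-cong f≗g n = cong -G_ (f≗g n)

  shift-cong : ∀ {f g} → f ≗ g → shift f ≗ shift g
  shift-cong f≗g zero    = refl
  shift-cong f≗g (suc n) = f≗g n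

  *ₛ-cong : ∀ {f f′ g g′} → f ≗ f′ → g ≗ g′ → f *ₛ g ≗ f′ *ₛ g′
  *ₛ-cong f≗f′ g≗g′ zero    = cong₂ _*G_ (f≗f′ 0) (g≗g′ 0)
  *ₛ-cong f≗f′ g≗g′ (suc n) =
    cong₂ _+G_ (cong₂ _*G_ (f≗f′ 0) (g≗g′ (suc n))) (*ₛ-cong (f≗f′ ∘ suc) g≗g′ n)

  *ₛ-zeroˡ : ∀ g → 0ₛ *ₛ g ≗ 0ₛ
  *ₛ-zeroˡ g zero    = *G-zeroˡ (g 0)
  *ₛ-zeroˡ g (suc n) = trans (cong₂ _+G_ (*G-zeroˡ (g (suc n))) (*ₛ-zeroˡ g n)) (+G-identityˡ 0G)

  *ₛ-distribʳ : ∀ g f f′ → (f +ₛ f′) *ₛ g ≗ f *ₛ g +ₛ f′ *ₛ g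
  *ₛ-distribʳ g f f′ zero    = *G-distribʳ (g 0) (f 0) (f′ 0)
  *ₛ-distribʳ g f f′ (suc n) =
    trans (cong₂ _+G_ (*G-distribʳ (g (suc n)) (f 0) (f′ 0)) (*ₛ-distribʳ g (tail f) (tail f′) n))
          (solve 4 (λ a b c d → (a :+ b) :+ (c :+ d) := (a :+ c) :+ (b :+ d)) refl
            (f 0 *G g (suc n)) (f′ 0 *G g (suc n)) ((tail f *ₛ g) n) ((tail f′ *ₛ g) n))

  *ₛ-distribˡ : ∀ f g g′ → f *ₛ (g +ₛ g′) ≗ f *ₛ g +ₛ f *ₛ g′
  *ₛ-distribˡ f g g′ zero    = *G-distribˡ (f 0) (g 0) (g′ 0)
  *ₛ-distribˡ f g g′ (suc n) =
    trans (cong₂ _+G_ (*G-distribˡ (f 0) (g (suc n)) (g′ (suc n))) (*ₛ-distribˡ (tail f) g g′ n))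
          (solve 4 (λ a b c d → (a :+ b) :+ (c :+ d) := (a :+ c) :+ (b :+ d)) refl
            (f 0 *G g (suc n)) (f 0 *G g′ (suc n)) ((tail f *ₛ g) n) ((tail f *ₛ g′) n))

  shift-*ₛ : ∀ f g → shift f *ₛ g ≗ shift (f *ₛ g)
  shift-*ₛ f g zero    = *G-zeroˡ (g 0)
  shift-*ₛ f g (suc n) = trans (cong (_+G (f *ₛ g) n) (*G-zeroˡ (g (suc n)))) (+G-identityˡ ((f *ₛ g) n))

  const-*ₛ : ∀ c g → const c *ₛ g ≗ c ·ₛ g
  const-*ₛ c g zero    = refl
  const-*ₛ c g (suc n) = trans (cong (c *G g (suc n) +G_) (*ₛ-zeroˡ g n)) (+G-identityʳ (c *G g (suc n)))

  ·ₛ-*ₛ : ∀ c f g → (c ·ₛ f) *ₛ g ≗ c ·ₛ (f *ₛ g)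
  ·ₛ-*ₛ c f g zero    = *G-assoc c (f 0) (g 0)
  ·ₛ-*ₛ c f g (suc n) =
    trans (cong₂ _+G_ (*G-assoc c (f 0) (g (suc n))) (·ₛ-*ₛ c (tail f) g n))
          (sym (*G-distribˡ c (f 0 *G g (suc n)) ((tail f *ₛ g) n)))

  *ₛ-unfold : ∀ f g → f *ₛ g ≗ f 0 ·ₛ g +ₛ shift (tail f *ₛ g)
  *ₛ-unfold f g zero    = sym (+G-identityʳ (f 0 *G g 0))
  *ₛ-unfold f g (suc n) = refl

  *ₛ-comm : ∀ f g → f *ₛ g ≗ g *ₛ f
  *ₛ-comm f g zero          = *G-comm (f 0) (g 0)
  *ₛ-comm f g (suc zero)    =
    solve 4 (λ a b c d → a :* b :+ c :* d := d :* c :+ b :* a) refl (f 0) (g 1) (f 1) (g 0)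
  *ₛ-comm f g (suc (suc m)) = begin
    f 0 *G g (2+ m) +G (tail f *ₛ g) (suc m)                          ≡⟨ cong (f 0 *G g (2+ m) +G_) (*ₛ-comm (tail f) g (suc m)) ⟩
    f 0 *G g (2+ m) +G (g 0 *G f (2+ m) +G (tail g *ₛ tail f) m)
      ≡⟨ cong (λ z → f 0 *G g (2+ m) +G (g 0 *G f (2+ m) +G z)) (*ₛ-comm (tail g) (tail f) m) ⟩
    f 0 *G g (2+ m) +G (g 0 *G f (2+ m) +G (tail f *ₛ tail g) m)
      ≡⟨ solve 3 (λ a b c → a :+ (b :+ c) := b :+ (a :+ c)) refl (f 0 *G g (2+ m)) (g 0 *G f (2+ m)) ((tail f *ₛ tail g) m) ⟩
    g 0 *G f (2+ m) +G (f 0 *G g (2+ m) +G (tail f *ₛ tail g) m)      ≡⟨ cong (g 0 *G f (2+ m) +G_) (*ₛ-comm (tail g) f (suc m)) ⟨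
    g 0 *G f (2+ m) +G (tail g *ₛ f) (suc m)                          ∎
    where
    open ≡-Reasoning
    2+ : ℕ → ℕ
    2+ m = suc (suc m)

  *ₛ-assoc : ∀ f g h → (f *ₛ g) *ₛ h ≗ f *ₛ (g *ₛ h)
  *ₛ-assoc f g h zero    = *G-assoc (f 0) (g 0) (h 0)
  *ₛ-assoc f g h (suc n) =
    trans (unfold (suc n)) (cong (f 0 *G (g *ₛ h) (suc n) +G_) (*ₛ-assoc (tail f) g h n))
    where
    open ≗-Reasoning
    unfold : (f *ₛ g) *ₛ h ≗ f 0 ·ₛ (g *ₛ h) +ₛ shift ((tail f *ₛ g) *ₛ h)
    unfold = begin
      (f *ₛ g) *ₛ h                                  ≈⟨ *ₛ-cong (*ₛ-unfold f g) (λ _ → refl) ⟩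
      (f 0 ·ₛ g +ₛ shift (tail f *ₛ g)) *ₛ h         ≈⟨ *ₛ-distribʳ h _ _ ⟩
      (f 0 ·ₛ g) *ₛ h +ₛ shift (tail f *ₛ g) *ₛ h    ≈⟨ +ₛ-cong (·ₛ-*ₛ (f 0) g h) (shift-*ₛ (tail f *ₛ g) h) ⟩
      f 0 ·ₛ (g *ₛ h) +ₛ shift ((tail f *ₛ g) *ₛ h)  ∎

  *ₛ-identityˡ : ∀ g → 1ₛ *ₛ g ≗ g
  *ₛ-identityˡ g n = trans (const-*ₛ 1G g n) (*G-identityˡ (g n))

  isCommutativeRing : IsCommutativeRing _≗_ _+ₛ_ _*ₛ_ -ₛ_ 0ₛ 1ₛ
  isCommutativeRing = record
    { isRing = record
      { +-isAbelianGroup = record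
        { isGroup = record
          { isMonoid = record
            { isSemigroup = record
              { isMagma = record { isEquivalence = Setoid.isEquivalence (ℕ →-setoid ℤ[i]) ; ∙-cong = +ₛ-cong }
              ; assoc = λ f g h n → +G-assoc (f n) (g n) (h n) }
            ; identity = (λ f n → +G-identityˡ (f n)) , (λ f n → +G-identityʳ (f n)) }
          ; inverse = (λ f n → -G-inverseˡ (f n)) , (λ f n → -G-inverseʳ (f n))
          ; ⁻¹-cong = -ₛ-cong }
        ; comm = λ f g n → +G-comm (f n) (g n) }
      ; *-cong = *ₛ-cong
      ; *-assoc = *ₛ-assoc
      ; *-identity = *ₛ-identityˡ , (λ g n → trans (*ₛ-comm g 1ₛ n) (*ₛ-identityˡ g n))
      ; distrib = *ₛ-distribˡ , *ₛ-distribʳ }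
    ; *-comm = *ₛ-comm }

  commutativeRing : CommutativeRing _ _
  commutativeRing = record { isCommutativeRing = isCommutativeRing }

  ℤ-homomorphism : CommutativeRing.rawRing ℤP.+-*-commutativeRing
                     -Raw-AlmostCommutative⟶ fromCommutativeRing commutativeRing
  ℤ-homomorphism = record
    { ⟦_⟧    = const ∘ ι
    ; +-homo = λ x y → λ { zero → refl ; (suc n) → refl }
    ; *-homo = λ x y → λ { zero → ι-* x y
                         ; (suc n) → sym (trans (cong₂ _+G_ (*G-zeroʳ (ι x)) (*ₛ-zeroˡ (const (ι y)) n)) (+G-identityˡ 0G)) }
    ; -‿homo = λ x → λ { zero → refl ; (suc n) → refl }
    ; 0-homo = λ { zero → refl ; (suc n) → refl }
    ; 1-homo = λ { zero → refl ; (suc n) → refl } }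

  const-ι-≟ : ∀ x y → Maybe (const (ι x) ≗ const (ι y))
  const-ι-≟ x y with x ℤ.≟ y
  ... | yes refl = just (λ _ → refl)
  ... | no _     = nothing

open SeqRing using (+ₛ-cong; -ₛ-cong; shift-cong; *ₛ-cong; *ₛ-zeroˡ; *ₛ-identityˡ; *ₛ-comm; shift-*ₛ; const-*ₛ; *ₛ-unfold)
module SeqSolver = RingSolver _ (fromCommutativeRing SeqRing.commutativeRing) SeqRing.ℤ-homomorphism SeqRing.const-ι-≟

DegBelow : Seq → ℕ → Set
DegBelow f n = ∀ m → n ≤ m → f m ≡ 0G

tail-DegBelow : ∀ {f n} → DegBelow f (suc n) → DegBelow (tail f) n
tail-DegBelow f<n m n≤m = f<n (suc m) (s≤s n≤m)

shift-DegBelow : ∀ {f n} → DegBelow f n → DegBelow (shift f) (suc n)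
shift-DegBelow f<n (suc m) (s≤s n≤m) = f<n m n≤m

DegBelow-pred : ∀ {f n} → DegBelow f (suc n) → f n ≡ 0G → DegBelow f n
DegBelow-pred {n = n} f<1+n fn≡0 m n≤m with ℕP.m≤n⇒m<n∨m≡n n≤m
... | inj₁ n<m  = f<1+n m n<m
... | inj₂ refl = fn≡0

DegBelow-mono : ∀ {f m n} → m ≤ n → DegBelow f m → DegBelow f n
DegBelow-mono m≤n f<m k n≤k = f<m k (ℕP.≤-trans m≤n n≤k)

+ₛ-DegBelow : ∀ {f g n} → DegBelow f n → DegBelow g n → DegBelow (f +ₛ g) n
+ₛ-DegBelow f<n g<n m n≤m = cong₂ _+G_ (f<n m n≤m) (g<n m n≤m)

-ₛ-DegBelow : ∀ {f n} → DegBelow f n → DegBelow (-ₛ f) n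
-ₛ-DegBelow f<n m n≤m = cong -G_ (f<n m n≤m)

constant-*ₛ : ∀ {f} g → DegBelow f 1 → f *ₛ g ≗ f 0 ·ₛ g
constant-*ₛ g f<1 zero    = refl
constant-*ₛ {f} g f<1 (suc n) =
  trans (cong (f 0 *G g (suc n) +G_) (trans (*ₛ-cong (λ m → tail-DegBelow f<1 m z≤n) (λ _ → refl) n) (*ₛ-zeroˡ g n)))
        (+G-identityʳ (f 0 *G g (suc n)))

*ₛ-suc : ∀ f {g} m → g (suc m) ≡ 0G → (f *ₛ g) (suc m) ≡ (tail f *ₛ g) m
*ₛ-suc f {g} m g[1+m]≡0 =
  trans (cong (λ z → f 0 *G z +G (tail f *ₛ g) m) g[1+m]≡0)
        (trans (cong (_+G (tail f *ₛ g) m) (*G-zeroʳ (f 0))) (+G-identityˡ ((tail f *ₛ g) m)))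

*ₛ-DegBelow : ∀ K {L f g} → DegBelow f (suc K) → DegBelow g (suc L) → DegBelow (f *ₛ g) (suc (K ℕ.+ L))
*ₛ-DegBelow zero    {L} {f} {g} f<1   g<1+L m L<m =
  trans (constant-*ₛ g f<1 m) (trans (cong (f 0 *G_) (g<1+L m L<m)) (*G-zeroʳ (f 0)))
*ₛ-DegBelow (suc K) {L} {f} {g} f<2+K g<1+L (suc m) (s≤s K+L<m) =
  trans (*ₛ-suc f m (g<1+L (suc m) (s≤s (ℕP.≤-trans (ℕP.m≤n+m L K) (ℕP.<⇒≤ K+L<m)))))
        (*ₛ-DegBelow K (tail-DegBelow f<2+K) g<1+L m K+L<m)

*ₛ-top : ∀ K {L f g} → DegBelow f (suc K) → DegBelow g (suc L) → (f *ₛ g) (K ℕ.+ L) ≡ f K *G g L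
*ₛ-top zero    {L} {f} {g} f<1   g<1+L = constant-*ₛ g f<1 L
*ₛ-top (suc K) {L} {f} {g} f<2+K g<1+L =
  trans (*ₛ-suc f (K ℕ.+ L) (g<1+L (suc (K ℕ.+ L)) (s≤s (ℕP.m≤n+m L K))))
        (*ₛ-top K (tail-DegBelow f<2+K) g<1+L)

*ₛ-subtop : ∀ K {L f g} → DegBelow f (suc (suc K)) → DegBelow g (suc (suc L)) →
            (f *ₛ g) (suc (K ℕ.+ L)) ≡ f (suc K) *G g L +G f K *G g (suc L)
*ₛ-subtop zero    {L} {f} {g} f<2   g<2+L =
  trans (cong (f 0 *G g (suc L) +G_) (constant-*ₛ g (tail-DegBelow f<2) L))
        (+G-comm (f 0 *G g (suc L)) (f 1 *G g L))
*ₛ-subtop (suc K) {L} {f} {g} f<3+K g<2+L =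
  trans (*ₛ-suc f (suc (K ℕ.+ L)) (g<2+L (suc (suc (K ℕ.+ L))) (s≤s (s≤s (ℕP.m≤n+m L K)))))
        (*ₛ-subtop K (tail-DegBelow f<3+K) g<2+L)

zero-or-leading : ∀ {f} n → DegBelow f n → f ≗ 0ₛ ⊎ Σ[ k ∈ ℕ ] DegBelow f (suc k) × f k ≢ 0G
zero-or-leading         zero    f<0   = inj₁ (λ m → f<0 m z≤n)
zero-or-leading {f = f} (suc n) f<1+n with f n ≟G 0G
... | yes fn≡0 = zero-or-leading n (DegBelow-pred f<1+n fn≡0)
... | no  fn≢0 = inj₂ (n , f<1+n , fn≢0)

*ₛ≗const⇒constant : ∀ {u v c m n} → DegBelow u m → DegBelow v n → u *ₛ v ≗ const c → c ≢ 0G → DegBelow u 1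
*ₛ≗const⇒constant {u} {v} {m = m} {n} u<m v<n uv≗c c≢0 with zero-or-leading m u<m | zero-or-leading n v<n
... | inj₁ u≗0 | _ = ⊥-elim (c≢0 (trans (sym (uv≗c 0)) (trans (cong (_*G v 0) (u≗0 0)) (*G-zeroˡ (v 0)))))
... | inj₂ _   | inj₁ v≗0 = ⊥-elim (c≢0 (trans (sym (uv≗c 0)) (trans (cong (u 0 *G_) (v≗0 0)) (*G-zeroʳ (u 0)))))
... | inj₂ (zero  , u<1   , _)     | inj₂ _ = u<1
... | inj₂ (suc k , u<2+k , uk≢0) | inj₂ (l , v<1+l , vl≢0) =
  ⊥-elim ([ uk≢0 , vl≢0 ]′ (x*y≡0⇒x≡0∨y≡0 _ _ (trans (sym (*ₛ-top (suc k) u<2+k v<1+l)) (uv≗c (suc (k ℕ.+ l))))))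

coeff-⊕ : ∀ p q → coeff (p ⊕ q) ≗ coeff p +ₛ coeff q
coeff-⊕ []      q       n       = sym (+G-identityˡ (coeff q n))
coeff-⊕ (a ∷ p) []      n       = sym (+G-identityʳ (coeff (a ∷ p) n))
coeff-⊕ (a ∷ p) (b ∷ q) zero    = refl
coeff-⊕ (a ∷ p) (b ∷ q) (suc n) = coeff-⊕ p q n

coeff-· : ∀ c p → coeff (c · p) ≗ c ·ₛ coeff p
coeff-· c []      n       = sym (*G-zeroʳ c)
coeff-· c (a ∷ p) zero    = refl
coeff-· c (a ∷ p) (suc n) = coeff-· c p n

coeff-0∷ : ∀ p → coeff (0G ∷ p) ≗ shift (coeff p)
coeff-0∷ p zero    = refl
coeff-0∷ p (suc n) = refl

coeff-⊗ : ∀ p q → coeff (p ⊗ q) ≗ coeff p *ₛ coeff q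
coeff-⊗ []      q n = sym (*ₛ-zeroˡ (coeff q) n)
coeff-⊗ (a ∷ p) q n = begin
  coeff ((a · q) ⊕ (0G ∷ (p ⊗ q))) n                   ≡⟨ coeff-⊕ (a · q) (0G ∷ (p ⊗ q)) n ⟩
  coeff (a · q) n +G coeff (0G ∷ (p ⊗ q)) n            ≡⟨ cong₂ _+G_ (coeff-· a q n) (trans (coeff-0∷ (p ⊗ q) n) (shift-cong (coeff-⊗ p q) n)) ⟩
  (a ·ₛ coeff q +ₛ shift (coeff p *ₛ coeff q)) n       ≡⟨ *ₛ-unfold (coeff (a ∷ p)) (coeff q) n ⟨
  (coeff (a ∷ p) *ₛ coeff q) n                         ∎
  where open ≡-Reasoning

coeff-⊖ : ∀ p → coeff (⊖ p) ≗ -ₛ coeff p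
coeff-⊖ p n = trans (coeff-· (-G 1G) p n) (solve 1 (λ x → :- con 1G :* x := :- x) refl (coeff p n))
  where open ℤ[i]-Solver

coeff-length : ∀ p → DegBelow (coeff p) (length p)
coeff-length []      m       _         = refl
coeff-length (a ∷ p) (suc m) (s≤s ℓ≤m) = coeff-length p m ℓ≤m

3∤16^n : ∀ n → ¬ 3 ∣ 16 ℕ.^ n
3∤16^n zero    3∣1         = case ∣1⇒≡1 3∣1 of λ ()
3∤16^n (suc n) 3∣16^[1+n] =
  3∤16^n n (∣m+n∣m⇒∣n (subst (3 ∣_) (ℕP.+-comm (16 ℕ.^ n) _) 3∣16^[1+n]) (∣m⇒∣m*n (16 ℕ.^ n) (divides 5 refl)))

16*N²*[m²]^[1+K]≢16^[1+K] : ∀ {m N} K → 3 ≤ m → N ≢ 0 →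
                             16 ℕ.* (N ℕ.* N) ℕ.* (m ℕ.* m) ℕ.^ suc K ≢ 16 ℕ.^ suc K
16*N²*[m²]^[1+K]≢16^[1+K] {1} K (s≤s ())
16*N²*[m²]^[1+K]≢16^[1+K] {2} K (s≤s (s≤s ()))
16*N²*[m²]^[1+K]≢16^[1+K] {3} {N} K _ _ eq =
  3∤16^n (suc K) (subst (3 ∣_) eq (∣n⇒∣m*n (16 ℕ.* (N ℕ.* N)) (∣m⇒∣m*n (9 ℕ.^ K) (divides 3 refl))))
16*N²*[m²]^[1+K]≢16^[1+K] {suc (suc (suc (suc m)))} {N} K _ N≢0 eq = ℕP.<-irrefl (sym eq) (begin-strict
  16 ℕ.^ suc K                                   <⟨ ℕP.m<m*n (16 ℕ.^ suc K) 16 {{ℕP.m^n≢0 16 (suc K)}} (s≤s (s≤s z≤n)) ⟩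
  16 ℕ.^ suc K ℕ.* 16                            ≡⟨ ℕP.*-comm (16 ℕ.^ suc K) 16 ⟩
  16 ℕ.* 16 ℕ.^ suc K
    ≤⟨ ℕP.*-mono-≤ (ℕP.m≤m*n 16 (N ℕ.* N) {{ℕP.m*n≢0 N N {{N≢0′}} {{N≢0′}}}}) (ℕP.^-monoˡ-≤ (suc K) 16≤m²) ⟩
  16 ℕ.* (N ℕ.* N) ℕ.* (m′ ℕ.* m′) ℕ.^ suc K      ∎)
  where
  open ℕP.≤-Reasoning
  m′ : ℕ
  m′ = 4 ℕ.+ m
  N≢0′ : ℕ.NonZero N
  N≢0′ = ℕ.≢-nonZero N≢0
  16≤m² : 16 ≤ m′ ℕ.* m′
  16≤m² = ℕP.*-mono-≤ {4} {m′} (ℕP.m≤m+n 4 m) (ℕP.m≤m+n 4 m)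

module Descent (d : ℤ) where

  X D : Seq
  X = shift 1ₛ
  D = const (ι d)

  -d four : ℤ[i]
  -d   = ι (ℤ.- d)
  four = ι (+ 4)

  Norm : Seq → Seq → Seq
  Norm p q = p *ₛ p +ₛ -ₛ ((X *ₛ X +ₛ D) *ₛ (q *ₛ q))

  descentP descentQ : Seq → Seq → Seq
  descentP p q = X *ₛ p +ₛ -ₛ ((X *ₛ X +ₛ D) *ₛ q)
  descentQ p q = X *ₛ q +ₛ -ₛ p

  X-*ₛ : ∀ f → X *ₛ f ≗ shift f
  X-*ₛ f n = trans (shift-*ₛ 1ₛ f n) (shift-cong (*ₛ-identityˡ f) n)

  [X²+D]-*ₛ : ∀ f → (X *ₛ X +ₛ D) *ₛ f ≗ shift (shift f) +ₛ ι d ·ₛ f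
  [X²+D]-*ₛ f = begin
    (X *ₛ X +ₛ D) *ₛ f           ≈⟨ solve 3 (λ x dc f → (x :* x :+ dc) :* f := x :* (x :* f) :+ dc :* f) (λ _ → refl) X D f ⟩
    X *ₛ (X *ₛ f) +ₛ D *ₛ f      ≈⟨ +ₛ-cong (λ n → trans (X-*ₛ (X *ₛ f) n) (shift-cong (X-*ₛ f) n)) (const-*ₛ (ι d) f) ⟩
    shift (shift f) +ₛ ι d ·ₛ f  ∎
    where
    open ≗-Reasoning
    open SeqSolver

  [X²+D]-*ₛ-square : ∀ q → (X *ₛ X +ₛ D) *ₛ (q *ₛ q) ≗ shift q *ₛ shift q +ₛ ι d ·ₛ (q *ₛ q)
  [X²+D]-*ₛ-square q = begin
    (X *ₛ X +ₛ D) *ₛ (q *ₛ q)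
      ≈⟨ solve 3 (λ x dc q → (x :* x :+ dc) :* (q :* q) := (x :* q) :* (x :* q) :+ dc :* (q :* q)) (λ _ → refl) X D q ⟩
    (X *ₛ q) *ₛ (X *ₛ q) +ₛ D *ₛ (q *ₛ q)  ≈⟨ +ₛ-cong (*ₛ-cong (X-*ₛ q) (X-*ₛ q)) (const-*ₛ (ι d) (q *ₛ q)) ⟩
    shift q *ₛ shift q +ₛ ι d ·ₛ (q *ₛ q)  ∎
    where
    open ≗-Reasoning
    open SeqSolver

  Norm-descent : ∀ p q → Norm (descentP p q) (descentQ p q) ≗ (-ₛ D) *ₛ Norm p q
  Norm-descent p q = solve 4 (λ p q x dc →
      let x²+d = x :* x :+ dc in
      (x :* p :- x²+d :* q) :* (x :* p :- x²+d :* q) :- x²+d :* ((x :* q :- p) :* (x :* q :- p))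
      := (:- dc) :* (p :* p :- x²+d :* (q :* q))) (λ _ → refl) p q X D
    where open SeqSolver

  Norm-neg : ∀ p q → Norm p (-ₛ q) ≗ Norm p q
  Norm-neg p q = solve 4 (λ p q x dc →
      p :* p :- (x :* x :+ dc) :* ((:- q) :* (:- q)) := p :* p :- (x :* x :+ dc) :* (q :* q))
    (λ _ → refl) p q X D
    where open SeqSolver

  descent-relation : ∀ p q → X *ₛ descentP p q +ₛ (X *ₛ X +ₛ D) *ₛ descentQ p q ≗ -ₛ (D *ₛ p)
  descent-relation p q = solve 4 (λ p q x dc →
      let x²+d = x :* x :+ dc in
      x :* (x :* p :- x²+d :* q) :+ x²+d :* (x :* q :- p) := :- (dc :* p)) (λ _ → refl) p q X D
    where open SeqSolver

  Norm≗const⇒high : ∀ {p q c} → Norm p q ≗ const c → ∀ n →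
                    (p *ₛ p) (suc n) ≡ (shift q *ₛ shift q) (suc n) +G ι d *G (q *ₛ q) (suc n)
  Norm≗const⇒high {p} {q} N≗c n = x-y≡0⇒x≡y _ _
    (trans (cong (λ z → (p *ₛ p) (suc n) +G -G z) (sym ([X²+D]-*ₛ-square q (suc n)))) (N≗c (suc n)))

  x+d*0≡x : ∀ x → x +G ι d *G 0G ≡ x
  x+d*0≡x x = trans (cong (x +G_) (*G-zeroʳ (ι d))) (+G-identityʳ x)

  module _ j {p q c} (p<2+j : DegBelow p (suc (suc j))) (q<1+j : DegBelow q (suc j)) (N≗c : Norm p q ≗ const c) where

    Norm-leading : p (suc j) *G p (suc j) ≡ q j *G q j
    Norm-leading = begin
      p (suc j) *G p (suc j)                                                  ≡⟨ *ₛ-top (suc j) p<2+j p<2+j ⟨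
      (p *ₛ p) (suc j ℕ.+ suc j)                                              ≡⟨ Norm≗const⇒high N≗c (j ℕ.+ suc j) ⟩
      (shift q *ₛ shift q) (suc j ℕ.+ suc j) +G ι d *G (q *ₛ q) (suc j ℕ.+ suc j)
        ≡⟨ cong₂ (λ u v → u +G ι d *G v) (*ₛ-top (suc j) q′<2+j q′<2+j) (*ₛ-DegBelow j q<1+j q<1+j _ 1+2j≤2+2j) ⟩
      q j *G q j +G ι d *G 0G                                                 ≡⟨ x+d*0≡x (q j *G q j) ⟩
      q j *G q j                                                              ∎
      where
      open ≡-Reasoning
      q′<2+j : DegBelow (shift q) (suc (suc j))
      q′<2+j = shift-DegBelow q<1+j
      1+2j≤2+2j : suc (j ℕ.+ j) ≤ suc j ℕ.+ suc j
      1+2j≤2+2j = s≤s (ℕP.+-monoʳ-≤ j (ℕP.n≤1+n j))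

    Norm-subleading : p (suc j) *G p j +G p j *G p (suc j) ≡ q j *G shift q j +G shift q j *G q j
    Norm-subleading = begin
      p (suc j) *G p j +G p j *G p (suc j)                                    ≡⟨ *ₛ-subtop j p<2+j p<2+j ⟨
      (p *ₛ p) (suc (j ℕ.+ j))                                                ≡⟨ Norm≗const⇒high N≗c (j ℕ.+ j) ⟩
      (shift q *ₛ shift q) (suc (j ℕ.+ j)) +G ι d *G (q *ₛ q) (suc (j ℕ.+ j))
        ≡⟨ cong₂ (λ u v → u +G ι d *G v) (*ₛ-subtop j q′<2+j q′<2+j) (*ₛ-DegBelow j q<1+j q<1+j _ ℕP.≤-refl) ⟩
      (q j *G shift q j +G shift q j *G q j) +G ι d *G 0G                     ≡⟨ x+d*0≡x (q j *G shift q j +G shift q j *G q j) ⟩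
      q j *G shift q j +G shift q j *G q j                                    ∎
      where
      open ≡-Reasoning
      q′<2+j : DegBelow (shift q) (suc (suc j))
      q′<2+j = shift-DegBelow q<1+j

    Norm-leading≡0 : p (suc j) ≡ 0G → q j ≡ 0G
    Norm-leading≡0 a≡0 = [ id , id ]′ (x*y≡0⇒x≡0∨y≡0 (q j) (q j)
      (trans (sym Norm-leading) (trans (cong (λ z → z *G z) a≡0) (*G-zeroˡ 0G))))

  Norm-0 : ∀ p q → q 0 ≡ 0G → Norm p q 0 ≡ p 0 *G p 0
  Norm-0 p q q0≡0 = trans (cong (λ z → p 0 *G p 0 +G -G ((0G *G 0G +G ι d) *G (z *G z))) q0≡0)
    (solve 2 (λ x dc → x :+ :- ((con 0G :* con 0G :+ dc) :* (con 0G :* con 0G)) := x) refl (p 0 *G p 0) (ι d))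
    where open ℤ[i]-Solver

  module DescentStep {j p q c} (p<2+j : DegBelow p (suc (suc j))) (q<1+j : DegBelow q (suc j))
                     (N≗c : Norm p q ≗ const c) (a≢0 : p (suc j) ≢ 0G) (qj≡a : q j ≡ p (suc j)) where

    a : ℤ[i]
    a = p (suc j)

    P′ Q′ : Seq
    P′ = descentP p q
    Q′ = descentQ p q

    p[j]≡shift-q[j] : p j ≡ shift q j
    p[j]≡shift-q[j] = *G-cancelˡ (a +G a) (a≢0 ∘ x+x≡0⇒x≡0) (begin
      (a +G a) *G p j                ≡⟨ solve 2 (λ a x → (a :+ a) :* x := a :* x :+ x :* a) refl a (p j) ⟩
      a *G p j +G p j *G a           ≡⟨ Norm-subleading j p<2+j q<1+j N≗c ⟩
      q j *G s +G s *G q j           ≡⟨ cong (λ z → z *G s +G s *G z) qj≡a ⟩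
      a *G s +G s *G a               ≡⟨ solve 2 (λ a x → a :* x :+ x :* a := (a :+ a) :* x) refl a s ⟩
      (a +G a) *G s                  ∎)
      where
      open ≡-Reasoning
      open ℤ[i]-Solver
      s : ℤ[i]
      s = shift q j

    p≡shift-q : ∀ m → j ≤ m → p m ≡ shift q m
    p≡shift-q m j≤m with ℕP.m≤n⇒m<n∨m≡n j≤m
    ... | inj₂ refl = p[j]≡shift-q[j]
    ... | inj₁ (s≤s {n = m′} j≤m′) with ℕP.m≤n⇒m<n∨m≡n j≤m′
    ...   | inj₂ refl = sym qj≡a
    ...   | inj₁ j<m′ = trans (p<2+j (suc m′) (s≤s j<m′)) (sym (q<1+j m′ j<m′))

    Q′<j : DegBelow Q′ j
    Q′<j m j≤m = begin
      (X *ₛ q) m +G -G p m     ≡⟨ cong₂ (λ u v → u +G -G v) (X-*ₛ q m) (p≡shift-q m j≤m) ⟩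
      shift q m +G -G shift q m ≡⟨ -G-inverseʳ (shift q m) ⟩
      0G                        ∎
      where open ≡-Reasoning

    P′<1+j : DegBelow P′ (suc j)
    P′<1+j (suc m) (s≤s j≤m) = begin
      (X *ₛ p) (suc m) +G -G ((X *ₛ X +ₛ D) *ₛ q) (suc m)  ≡⟨ cong₂ (λ u v → u +G -G v) (X-*ₛ p (suc m)) ([X²+D]-*ₛ q (suc m)) ⟩
      p m +G -G (shift q m +G ι d *G q (suc m))
        ≡⟨ cong₂ (λ u v → u +G -G (shift q m +G ι d *G v)) (p≡shift-q m j≤m) (q<1+j (suc m) (s≤s j≤m)) ⟩
      shift q m +G -G (shift q m +G ι d *G 0G)             ≡⟨ cong (λ z → shift q m +G -G z) (x+d*0≡x (shift q m)) ⟩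
      shift q m +G -G shift q m                            ≡⟨ -G-inverseʳ (shift q m) ⟩
      0G                                                   ∎
      where open ≡-Reasoning

    Norm-P′Q′ : Norm P′ Q′ ≗ const (-d *G c)
    Norm-P′Q′ = begin
      Norm P′ Q′               ≈⟨ Norm-descent p q ⟩
      (-ₛ D) *ₛ Norm p q       ≈⟨ *ₛ-cong (λ _ → refl) N≗c ⟩
      (-ₛ D) *ₛ const c        ≈⟨ *ₛ-comm (-ₛ D) (const c) ⟩
      const c *ₛ (-ₛ D)        ≈⟨ const-*ₛ c (-ₛ D) ⟩
      c ·ₛ (-ₛ D)              ≈⟨ c*[-D]≗-dc ⟩
      const (-d *G c)          ∎
      where
      open ≗-Reasoning
      c*[-D]≗-dc : c ·ₛ (-ₛ D) ≗ const (-d *G c)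
      c*[-D]≗-dc zero    = *G-comm c -d
      c*[-D]≗-dc (suc n) = *G-zeroʳ c

    P′[j]+Q′[j-1]≡-d*a : P′ j +G shift Q′ j ≡ -d *G a
    P′[j]+Q′[j-1]≡-d*a = begin
      P′ j +G shift Q′ j                                             ≡⟨ cong (P′ j +G_) (x+d*0≡x (shift Q′ j)) ⟨
      P′ j +G (shift Q′ j +G ι d *G 0G)                              ≡⟨ cong (λ z → P′ j +G (shift Q′ j +G ι d *G z)) (Q′<j (suc j) (ℕP.n≤1+n j)) ⟨
      P′ j +G (shift Q′ j +G ι d *G Q′ (suc j))                      ≡⟨ cong₂ _+G_ (X-*ₛ P′ (suc j)) ([X²+D]-*ₛ Q′ (suc j)) ⟨
      (X *ₛ P′ +ₛ (X *ₛ X +ₛ D) *ₛ Q′) (suc j)                       ≡⟨ descent-relation p q (suc j) ⟩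
      -G (D *ₛ p) (suc j)                                            ≡⟨ cong -G_ (const-*ₛ (ι d) p (suc j)) ⟩
      -G (ι d *G a)                                                  ≡⟨ solve 2 (λ x y → :- (x :* y) := (:- x) :* y) refl (ι d) a ⟩
      -d *G a                                                        ∎
      where
      open ≡-Reasoning
      open ℤ[i]-Solver

  -- One descent step turns the leading coefficient a and the constant c into a′ and c′ with
  -- 2a′ = -d·a and c′ = -d·c; at the bottom (p constant, q = 0) c = -d·a². Clearing the 2s gives:
  Invariant : ℕ → ℤ[i] → ℤ[i] → Set
  Invariant j a c = four *G (a *G a) *G -d ^ suc j ≡ c *G four ^ suc j

  module _ (d≢0 : d ≢ 0ℤ) where

    -d≢0 : -d ≢ 0G
    -d≢0 -d≡0 = d≢0 (ℤP.neg-injective (cong re -d≡0))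

    Invariant-base : ∀ a c → -d *G (a *G a) ≡ c → Invariant 0 a c
    Invariant-base a c -da²≡c = begin
      four *G (a *G a) *G (-d *G 1G)  ≡⟨ solve 3 (λ f m a → f :* (a :* a) :* (m :* con 1G) := f :* (m :* (a :* a))) refl four -d a ⟩
      four *G (-d *G (a *G a))        ≡⟨ cong (four *G_) -da²≡c ⟩
      four *G c                       ≡⟨ solve 2 (λ f c → f :* c := c :* (f :* con 1G)) refl four c ⟩
      c *G (four *G 1G)               ∎
      where
      open ≡-Reasoning
      open ℤ[i]-Solver

    Invariant-step : ∀ k a a′ c → a′ +G a′ ≡ -d *G a → Invariant k a′ (-d *G c) → Invariant (suc k) a c
    Invariant-step k a a′ c 2a′≡-da inv = *G-cancelˡ -d -d≢0 (begin
      -d *G (four *G (a *G a) *G (-d *G A))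
        ≡⟨ solve 4 (λ m f a A → m :* (f :* (a :* a) :* (m :* A)) := f :* ((m :* a) :* (m :* a)) :* A) refl -d four a A ⟩
      four *G ((-d *G a) *G (-d *G a)) *G A       ≡⟨ cong (λ z → four *G (z *G z) *G A) 2a′≡-da ⟨
      four *G ((a′ +G a′) *G (a′ +G a′)) *G A
        ≡⟨ solve 2 (λ x A → con four :* ((x :+ x) :* (x :+ x)) :* A := con four :* (con four :* (x :* x) :* A)) refl a′ A ⟩
      four *G (four *G (a′ *G a′) *G A)           ≡⟨ cong (four *G_) inv ⟩
      four *G ((-d *G c) *G B)                    ≡⟨ solve 4 (λ f m c B → f :* ((m :* c) :* B) := m :* (c :* (f :* B))) refl four -d c B ⟩
      -d *G (c *G (four *G B))                    ∎)
      where
      open ≡-Reasoning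
      open ℤ[i]-Solver
      A B : ℤ[i]
      A = -d ^ suc k
      B = four ^ suc k

    descent-invariant : ∀ j {p q c} → DegBelow p (suc (suc j)) → DegBelow q (suc j) →
                        Norm p q ≗ const c → p (suc j) ≢ 0G → Invariant j (p (suc j)) c
    descent-invariant-normalised : ∀ j {p q c} → DegBelow p (suc (suc j)) → DegBelow q (suc j) →
                                   Norm p q ≗ const c → p (suc j) ≢ 0G → q j ≡ p (suc j) → Invariant j (p (suc j)) c

    descent-invariant j {p} {q} p<2+j q<1+j N≗c a≢0 =
      [ descent-invariant-normalised j p<2+j q<1+j N≗c a≢0
      , (λ qj≡-a → descent-invariant-normalised j p<2+j (λ m le → cong -G_ (q<1+j m le))
                     (λ n → trans (Norm-neg p q n) (N≗c n)) a≢0 (trans (cong -G_ qj≡-a) (-G-involutive (p (suc j)))))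
      ]′ (x²≡y²⇒y≡±x (p (suc j)) (q j) (Norm-leading j p<2+j q<1+j N≗c))

    descent-invariant-normalised zero {p} {q} {c} p<2 q<1 N≗c a≢0 q0≡a =
      Invariant-base a c (*G-cancelˡ -d -d≢0 (begin
        -d *G (-d *G (a *G a))    ≡⟨ solve 2 (λ m a → m :* (m :* (a :* a)) := (m :* a) :* (m :* a)) refl -d a ⟩
        (-d *G a) *G (-d *G a)    ≡⟨ cong (λ z → z *G z) P′0≡-da ⟨
        P′ 0 *G P′ 0              ≡⟨ Norm-0 P′ Q′ (Q′<j 0 z≤n) ⟨
        Norm P′ Q′ 0              ≡⟨ Norm-P′Q′ 0 ⟩
        -d *G c                   ∎))
      where
      open DescentStep p<2 q<1 N≗c a≢0 q0≡a
      open ≡-Reasoning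
      open ℤ[i]-Solver
      P′0≡-da : P′ 0 ≡ -d *G a
      P′0≡-da = trans (sym (+G-identityʳ (P′ 0))) P′[j]+Q′[j-1]≡-d*a
    descent-invariant-normalised (suc k) {p} {q} {c} p<2+j q<1+j N≗c a≢0 qj≡a =
      [ (λ Q′k≡a′ → Invariant-step k a a′ c (2a′≡-da Q′k≡a′)
                      (descent-invariant k P′<1+j Q′<j Norm-P′Q′ (a′≢0 Q′k≡a′)))
      , (λ Q′k≡-a′ → ⊥-elim (-da≢0 (trans (sym P′[j]+Q′[j-1]≡-d*a) (trans (cong (a′ +G_) Q′k≡-a′) (-G-inverseʳ a′)))))
      ]′ (x²≡y²⇒y≡±x a′ (Q′ k) (Norm-leading k P′<1+j Q′<j Norm-P′Q′))
      where
      open DescentStep p<2+j q<1+j N≗c a≢0 qj≡a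
      a′ : ℤ[i]
      a′ = P′ (suc k)
      -da≢0 : -d *G a ≢ 0G
      -da≢0 -da≡0 = [ -d≢0 , a≢0 ]′ (x*y≡0⇒x≡0∨y≡0 -d a -da≡0)
      2a′≡-da : Q′ k ≡ a′ → a′ +G a′ ≡ -d *G a
      2a′≡-da Q′k≡a′ = trans (cong (a′ +G_) (sym Q′k≡a′)) P′[j]+Q′[j-1]≡-d*a
      a′≢0 : Q′ k ≡ a′ → a′ ≢ 0G
      a′≢0 Q′k≡a′ a′≡0 = -da≢0 (trans (sym (2a′≡-da Q′k≡a′)) (cong₂ _+G_ a′≡0 a′≡0))

  ¬Invariant[-1] : 3 ≤ ℤ.∣ d ∣ → ∀ K {a} → a ≢ 0G → ¬ Invariant K a (-G 1G)
  ¬Invariant[-1] 3≤∣d∣ K {a} a≢0 inv =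
    16*N²*[m²]^[1+K]≢16^[1+K] K 3≤∣d∣ (a≢0 ∘ norm≡0⇒≡0G a) (begin
      16 ℕ.* (norm a ℕ.* norm a) ℕ.* (ℤ.∣ d ∣ ℕ.* ℤ.∣ d ∣) ℕ.^ suc K
        ≡⟨ cong₂ (λ u v → 16 ℕ.* u ℕ.* v ℕ.^ suc K) (norm-* a a) (trans (norm-ι (ℤ.- d)) (cong (λ z → z ℕ.* z) (ℤP.∣-i∣≡∣i∣ d))) ⟨
      16 ℕ.* norm (a *G a) ℕ.* norm -d ℕ.^ suc K                      ≡⟨ cong₂ ℕ._*_ (norm-* four (a *G a)) (norm-^ -d (suc K)) ⟨
      norm (four *G (a *G a)) ℕ.* norm (-d ^ suc K)                   ≡⟨ norm-* (four *G (a *G a)) (-d ^ suc K) ⟨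
      norm (four *G (a *G a) *G -d ^ suc K)                           ≡⟨ cong norm inv ⟩
      norm (-G 1G *G four ^ suc K)                                    ≡⟨ norm-* (-G 1G) (four ^ suc K) ⟩
      1 ℕ.* norm (four ^ suc K)                                       ≡⟨ ℕP.*-identityˡ _ ⟩
      norm (four ^ suc K)                                             ≡⟨ norm-^ four (suc K) ⟩
      16 ℕ.^ suc K                                                    ∎)
    where open ≡-Reasoning

  Norm≗-1⇒q≗0 : 3 ≤ ℤ.∣ d ∣ → ∀ K {p q} → DegBelow p (suc (suc K)) → DegBelow q (suc K) →
                Norm p q ≗ const (-G 1G) → q ≗ 0ₛ
  Norm≗-1⇒q≗0 3≤∣d∣ K {p} {q} p<2+K q<1+K N≗-1 with p (suc K) ≟G 0G
  ... | no  a≢0 = ⊥-elim (¬Invariant[-1] 3≤∣d∣ K a≢0 (descent-invariant d≢0 K p<2+K q<1+K N≗-1 a≢0))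
    where
    d≢0 : d ≢ 0ℤ
    d≢0 refl = case 3≤∣d∣ of λ ()
  ... | yes a≡0 = lower K (DegBelow-pred p<2+K a≡0) (DegBelow-pred q<1+K (Norm-leading≡0 K p<2+K q<1+K N≗-1 a≡0))
    where
    lower : ∀ K → DegBelow p (suc K) → DegBelow q K → q ≗ 0ₛ
    lower zero    _     q<0 m = q<0 m z≤n
    lower (suc K) p<2+K q<1+K = Norm≗-1⇒q≗0 3≤∣d∣ K p<2+K q<1+K N≗-1

  coeff-X²+ : coeff (X²+ d) ≗ X *ₛ X +ₛ D
  coeff-X²+ n = trans (coeff≗ n) (sym (+ₛ-cong {g = D} (X-*ₛ X) (λ _ → refl) n))
    where
    coeff≗ : coeff (X²+ d) ≗ shift X +ₛ D
    coeff≗ zero                = sym (+G-identityˡ (ι d))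
    coeff≗ (suc zero)          = refl
    coeff≗ (suc (suc zero))    = refl
    coeff≗ (suc (suc (suc n))) = refl

  NegPell⇒Norm≗-1 : ∀ P Q → NegPell d P Q → Norm (coeff P) (coeff Q) ≗ const (-G 1G)
  NegPell⇒Norm≗-1 P Q pell = begin
    Norm (coeff P) (coeff Q)                                    ≈⟨ +ₛ-cong (coeff-⊗ P P) (-ₛ-cong (*ₛ-cong coeff-X²+ (coeff-⊗ Q Q))) ⟨
    coeff (P ⊗ P) +ₛ -ₛ (coeff (X²+ d) *ₛ coeff (Q ⊗ Q))       ≈⟨ +ₛ-cong {f = coeff (P ⊗ P)} (λ _ → refl) (-ₛ-cong (coeff-⊗ (X²+ d) (Q ⊗ Q))) ⟨
    coeff (P ⊗ P) +ₛ -ₛ coeff (X²+ d ⊗ (Q ⊗ Q))                 ≈⟨ +ₛ-cong {f = coeff (P ⊗ P)} (λ _ → refl) (coeff-⊖ (X²+ d ⊗ (Q ⊗ Q))) ⟨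
    coeff (P ⊗ P) +ₛ coeff (⊖ (X²+ d ⊗ (Q ⊗ Q)))                ≈⟨ coeff-⊕ (P ⊗ P) (⊖ (X²+ d ⊗ (Q ⊗ Q))) ⟨
    coeff ((P ⊗ P) ⊕ (⊖ (X²+ d ⊗ (Q ⊗ Q))))                     ≈⟨ pell ⟩
    coeff (-G 1G ∷ [])                                          ≈⟨ (λ { zero → refl ; (suc n) → refl }) ⟩
    const (-G 1G)                                               ∎
    where open ≗-Reasoning

open Descent using (Norm; X; D; X-*ₛ; NegPell⇒Norm≗-1; Norm≗-1⇒q≗0)

Norm[0]≗-1⇒q≗0 : ∀ K {p q} → DegBelow p (suc (suc K)) → DegBelow q (suc K) → Norm 0ℤ p q ≗ const (-G 1G) → q ≗ 0ₛ
Norm[0]≗-1⇒q≗0 K {p} {q} p<2+K q<1+K N≗-1 n = x+x≡0⇒x≡0 q[n]+q[n]≡0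
  where
  u v : Seq
  u = p +ₛ -ₛ (X 0ℤ *ₛ q)
  v = p +ₛ X 0ℤ *ₛ q
  uv≗-1 : u *ₛ v ≗ const (-G 1G)
  uv≗-1 = begin
    u *ₛ v                                           ≈⟨ SeqSolver.solve 4 (λ p q x dc →
        (p :- x :* q) :* (p :+ x :* q) := (p :* p :- (x :* x :+ dc) :* (q :* q)) :+ dc :* (q :* q))
        (λ _ → refl) p q (X 0ℤ) (D 0ℤ) ⟩
    Norm 0ℤ p q +ₛ D 0ℤ *ₛ (q *ₛ q)                  ≈⟨ +ₛ-cong N≗-1 (λ m → trans (const-*ₛ 0G (q *ₛ q) m) (*G-zeroˡ ((q *ₛ q) m))) ⟩
    const (-G 1G) +ₛ 0ₛ                              ≈⟨ (λ m → +G-identityʳ (const (-G 1G) m)) ⟩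
    const (-G 1G)                                    ∎
    where
    open ≗-Reasoning
    open SeqSolver using (_:+_; _:-_; _:*_; _:=_)
  Xq<2+K : DegBelow (X 0ℤ *ₛ q) (suc (suc K))
  Xq<2+K m le = trans (X-*ₛ 0ℤ q m) (shift-DegBelow q<1+K m le)
  u<1 : DegBelow u 1
  u<1 = *ₛ≗const⇒constant (+ₛ-DegBelow p<2+K (-ₛ-DegBelow Xq<2+K)) (+ₛ-DegBelow p<2+K Xq<2+K) uv≗-1 (λ ())
  v<1 : DegBelow v 1
  v<1 = *ₛ≗const⇒constant (+ₛ-DegBelow p<2+K Xq<2+K) (+ₛ-DegBelow p<2+K (-ₛ-DegBelow Xq<2+K))
          (λ m → trans (*ₛ-comm v u m) (uv≗-1 m)) (λ ())
  q[n]+q[n]≡0 : q n +G q n ≡ 0G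
  q[n]+q[n]≡0 = begin
    q n +G q n                                          ≡⟨ solve 2 (λ x w → w :+ w := (x :+ w) :- (x :- w)) refl (p (suc n)) (q n) ⟩
    (p (suc n) +G q n) +G -G (p (suc n) +G -G q n)     ≡⟨ cong (λ w → (p (suc n) +G w) +G -G (p (suc n) +G -G w)) (X-*ₛ 0ℤ q (suc n)) ⟨
    v (suc n) +G -G u (suc n)                           ≡⟨ cong₂ (λ a b → a +G -G b) (v<1 (suc n) (s≤s z≤n)) (u<1 (suc n) (s≤s z≤n)) ⟩
    0G                                                  ∎
    where
    open ≡-Reasoning
    open ℤ[i]-Solver

3≤∣d∣ : ∀ d → d ≢ 0ℤ → d ≢ + 1 → d ≢ -[1+ 0 ] → d ≢ + 2 → d ≢ -[1+ 1 ] → 3 ≤ ℤ.∣ d ∣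
3≤∣d∣ (+ 0)                  d≢0 _   _    _   _    = ⊥-elim (d≢0 refl)
3≤∣d∣ (+ 1)                  _   d≢1 _    _   _    = ⊥-elim (d≢1 refl)
3≤∣d∣ (+ 2)                  _   _   _    d≢2 _    = ⊥-elim (d≢2 refl)
3≤∣d∣ (+ suc (suc (suc _)))  _   _   _    _   _    = s≤s (s≤s (s≤s z≤n))
3≤∣d∣ -[1+ 0 ]               _   _   d≢-1 _   _    = ⊥-elim (d≢-1 refl)
3≤∣d∣ -[1+ 1 ]               _   _   _    _   d≢-2 = ⊥-elim (d≢-2 refl)
3≤∣d∣ -[1+ suc (suc _) ]     _   _   _    _   _    = s≤s (s≤s (s≤s z≤n))

coeff-pair-DegBelow : ∀ P Q → DegBelow (coeff P) (suc (suc (length P ℕ.+ length Q))) × DegBelow (coeff Q) (suc (length P ℕ.+ length Q))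
coeff-pair-DegBelow P Q =
  DegBelow-mono (ℕP.≤-trans (ℕP.m≤m+n (length P) (length Q)) (ℕP.m≤n+m _ 2)) (coeff-length P) ,
  DegBelow-mono (ℕP.≤-trans (ℕP.m≤n+m (length Q) (length P)) (ℕP.m≤n+m _ 1)) (coeff-length Q)

theorem1p1 : (d : ℤ) → d ≢ + 1 → d ≢ -[1+ 0 ] → d ≢ + 2 → d ≢ -[1+ 1 ] →
    (P Q : Poly) → NegPell d P Q → IsZeroPoly Q
theorem1p1 d d≢1 d≢-1 d≢2 d≢-2 P Q pell with d ℤ.≟ 0ℤ | coeff-pair-DegBelow P Q
... | yes refl | P< , Q< = Norm[0]≗-1⇒q≗0 _ P< Q< (NegPell⇒Norm≗-1 0ℤ P Q pell)
... | no  d≢0  | P< , Q< = Norm≗-1⇒q≗0 d (3≤∣d∣ d d≢0 d≢1 d≢-1 d≢2 d≢-2) _ P< Q< (NegPell⇒Norm≗-1 d P Q pell)
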